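{- There exist $n$, a symmetric Boolean function $f:\{0,1\}^n\to\{0,1\}$, costs $c_1,\ldots,c_n>0$, and probabilities $p_1,\ldots,p_n\in(0,1)$ such that $\mathcal{V}(f)<\mathcal{E}(f)$.
   Context: A Boolean function is symmetric if $f(x)$ depends only on the number of ones in $x$. The unknown assignment $x\in\{0,1\}^n$ has independent bits with $\Pr[x_i=1]=p_i$, and $p(x)=\prod_i p_i^{x_i}(1-p_i)^{1-x_i}$; testing $x_i$ reveals it at cost $c_i$. An adaptive evaluation strategy $\mathcal{A}$ for $f$ sequentially chooses the next variable to test based on previous outcomes and stops once the outcomes determine $f(x)$; $C(\mathcal{A},x)$ denotes the total cost of the tests it performs on $x$, and its expected cost is $\sum_{x\in\{0,1\}^n}C(\mathcal{A},x)p(x)$. $\mathcal{E}(f)$ is the minimum expected cost of an adaptive evaluation strategy for $f$. For $\ell\in\{0,1\}$ let $\mathcal{X}_\ell=\{x: f(x)=\ell\}$. An adaptive verification strategy consists of two adaptive evaluation strategies $\mathcal{A}_0,\mathcal{A}_1$ for $f$, with expected cost $\sum_{\ell\in\{0,1\}}\sum_{x\in\mathcal{X}_\ell}C(\mathcal{A}_\ell,x)p(x)$; $\mathcal{V}(f)$ is the minimum expected cost of an adaptive verification strategy for $f$. -}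

module Defs where

open import Data.Bool using (Bool; true; false; if_then_else_)
open import Data.Nat using (ℕ; zero; suc)
import Data.Nat as ℕ
open import Data.Fin using (Fin; zero; suc)
open import Data.List using (List; []; _∷_; _++_; map)
open import Data.List.Relation.Unary.All using (All)
open import Data.Product using (Σ; _×_; _,_; ∃)
open import Data.Rational using (ℚ; 0ℚ; 1ℚ; _+_; _*_; _-_; _≤_)
open import Relation.Binary.PropositionalEquality using (_≡_)
open import Relation.Nullary using (¬_)

-- An assignment x ∈ {0,1}^n (true = 1, false = 0).
Assignment : ℕ → Set
Assignment n = Fin n → Bool

ones : {n : ℕ} → Assignment n → ℕ
ones {zero}  x = 0
ones {suc n} x = (if x zero then 1 else 0) ℕ.+ ones (λ i → x (suc i))

Symmetric : {n : ℕ} → (Assignment n → Bool) → Set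
Symmetric {n} f = ∀ (x y : Assignment n) → ones x ≡ ones y → f x ≡ f y

cons : {n : ℕ} → Bool → Assignment n → Assignment (suc n)
cons b x zero    = b
cons b x (suc i) = x i

allAssignments : (n : ℕ) → List (Assignment n)
allAssignments zero    = (λ ()) ∷ []
allAssignments (suc n) =
  map (cons false) (allAssignments n) ++ map (cons true) (allAssignments n)

sumℚ : {A : Set} → List A → (A → ℚ) → ℚ
sumℚ []       g = 0ℚ
sumℚ (a ∷ as) g = g a + sumℚ as g

prodFin : {n : ℕ} → (Fin n → ℚ) → ℚ
prodFin {zero}  g = 1ℚ
prodFin {suc n} g = g zero * prodFin (λ i → g (suc i))

prob : {n : ℕ} → (Fin n → ℚ) → Assignment n → ℚ
prob p x = prodFin (λ i → if x i then p i else (1ℚ - p i))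

-- Adaptive strategies as decision trees: either stop, or test variable i
-- and continue with the first subtree if x_i = 0, the second if x_i = 1.
data Tree (n : ℕ) : Set where
  stop : Tree n
  test : Fin n → Tree n → Tree n → Tree n

branch : {n : ℕ} → Bool → Tree n → Tree n → Tree n
branch false t₀ t₁ = t₀
branch true  t₀ t₁ = t₁

cost : {n : ℕ} → (Fin n → ℚ) → Tree n → Assignment n → ℚ
costAt : {n : ℕ} → (Fin n → ℚ) → Bool → Tree n → Tree n → Assignment n → ℚ
cost c stop           x = 0ℚ
cost c (test i t₀ t₁) x = c i + costAt c (x i) t₀ t₁ x
costAt c false t₀ t₁ x = cost c t₀ x
costAt c true  t₀ t₁ x = cost c t₁ x

Consistent : {n : ℕ} → List (Fin n) → Assignment n → Assignment n → Set
Consistent S x y = All (λ i → x i ≡ y i) S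

Determined : {n : ℕ} → (Assignment n → Bool) → List (Fin n) → Assignment n → Set
Determined f S x = ∀ y → Consistent S x y → f y ≡ f x

ValidRun : {n : ℕ} → (Assignment n → Bool) → Tree n → List (Fin n) → Assignment n → Set
ValidAt : {n : ℕ} → (Assignment n → Bool) → Bool → Tree n → Tree n → List (Fin n) → Assignment n → Set
ValidRun f stop           S x = Determined f S x
ValidRun f (test i t₀ t₁) S x =
  ¬ Determined f S x × ValidAt f (x i) t₀ t₁ (i ∷ S) x
ValidAt f false t₀ t₁ S x = ValidRun f t₀ S x
ValidAt f true  t₀ t₁ S x = ValidRun f t₁ S x

IsEvalStrategy : {n : ℕ} → (Assignment n → Bool) → Tree n → Set
IsEvalStrategy {n} f A = ∀ (x : Assignment n) → ValidRun f A [] x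

expCost : {n : ℕ} → (Fin n → ℚ) → (Fin n → ℚ) → Tree n → ℚ
expCost {n} c p A = sumℚ (allAssignments n) (λ x → cost c A x * prob p x)

verCost : {n : ℕ} → (Assignment n → Bool) → (Fin n → ℚ) → (Fin n → ℚ) →
          Tree n → Tree n → ℚ
verCost {n} f c p A₀ A₁ =
  sumℚ (allAssignments n) (λ x → cost c (if f x then A₁ else A₀) x * prob p x)

IsE : {n : ℕ} → (Assignment n → Bool) → (Fin n → ℚ) → (Fin n → ℚ) → ℚ → Set
IsE {n} f c p e =
  (Σ (Tree n) λ A → IsEvalStrategy f A × expCost c p A ≡ e) ×
  (∀ (A : Tree n) → IsEvalStrategy f A → e ≤ expCost c p A)

IsV : {n : ℕ} → (Assignment n → Bool) → (Fin n → ℚ) → (Fin n → ℚ) → ℚ → Set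
IsV {n} f c p v =
  (Σ (Tree n) λ A₀ → Σ (Tree n) λ A₁ →
     IsEvalStrategy f A₀ × IsEvalStrategy f A₁ × verCost f c p A₀ A₁ ≡ v) ×
  (∀ (A₀ A₁ : Tree n) → IsEvalStrategy f A₀ → IsEvalStrategy f A₁ →
     v ≤ verCost f c p A₀ A₁)

-- A verification strategy (A₀, A₁) pays for A₀ only on f⁻¹(0) and for A₁ only on f⁻¹(1), so
-- 𝓥(f) is the sum of the optimal evaluation costs for the weights p·[f = 0] and p·[f = 1], while
-- 𝓔(f) is the optimal cost for the weight p. Each such optimum is computed exactly by dynamic
-- programming over subcubes: it is 0 on a subcube on which f is constant, and otherwise the minimum,
-- over the free variables i, of c_i times the weight of the subcube plus the optima of its two halves
-- x_i = 0 and x_i = 1. Induction along a strategy shows that this value bounds its weighted cost from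
-- below, and explicit decision trees attain it. For f(x) = [x has one or two ones] on four variables,
-- c = (3, 3, 4, 4) and p = (3/10, 4/5, 1/2, 7/10) this gives 𝓥(f) = 11513/1000 < 2303/200 = 𝓔(f).

module Submission where

open import Algebra.Bundles using (CommutativeMonoid)
open import Data.Bool using (Bool; true; false; T; _∧_; if_then_else_)
import Data.Bool as Bool
open import Data.Bool.Properties using (T-∧; T-≡; ∧-zeroʳ)
open import Data.Fin using (Fin; zero; suc; #_)
import Data.Fin as Fin
import Data.Fin.Properties as Fin
import Data.Integer as ℤ
open import Data.List using (List; []; _∷_; map; filter; allFin)
open import Data.List.Membership.Propositional using (_∈_)
open import Data.List.Membership.Propositional.Properties using (∈-allFin; ∈-filter⁺; ∈-map⁺)
open import Data.List.Relation.Unary.All as All using (All; []; _∷_)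
open import Data.List.Relation.Unary.Any as Any using (Any; here; there)
open import Data.List.Relation.Unary.Any.Properties using (++⁺ˡ; ++⁺ʳ; map⁺)
open import Data.Maybe using (Maybe; just; nothing; fromMaybe; is-nothing)
open import Data.Nat using (ℕ; zero; suc)
import Data.Nat as ℕ
open import Data.Product using (Σ; _×_; _,_; ∃; proj₁; proj₂)
open import Data.Rational using (ℚ; 0ℚ; 1ℚ; _/_; _+_; _*_; _-_; -_; _≤_; _<_; nonNegative)
open import Data.Rational.Properties
open import Data.Sum using (_⊎_; inj₁; inj₂)
open import Data.Vec.Functional using (Vector; head; tail; updateAt)
open import Data.Vec.Functional.Properties using (updateAt-updates; updateAt-minimal)
open import Function using (_∘_; const; Equivalence)
open import Relation.Binary.Bundles using (DecTotalOrder)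
open import Relation.Binary.Core using (_Preserves_⟶_)
open import Relation.Binary.PropositionalEquality
open import Relation.Nullary using (¬_; Dec; yes; no; does; isYes; isNo)
open import Relation.Nullary.Decidable
  using (map′; T?; _→-dec_; _×-dec_; dec-true; dec-false; toWitness; toWitnessFalse)

open import Algebra.Properties.CommutativeSemigroup (CommutativeMonoid.commutativeSemigroup +-0-commutativeMonoid)
  using () renaming (interchange to +-interchange)
open import Data.List.Extrema (DecTotalOrder.totalOrder ≤-decTotalOrder) using (min; min≤⊤; min≤v⁺)

open import Defs

+-nonNeg : ∀ {p q} → 0ℚ ≤ p → 0ℚ ≤ q → 0ℚ ≤ p + q
+-nonNeg 0≤p 0≤q = +-mono-≤ 0≤p 0≤q

*-nonNeg : ∀ {p q} → 0ℚ ≤ p → 0ℚ ≤ q → 0ℚ ≤ p * q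
*-nonNeg {p} {q} 0≤p 0≤q = nonNegative⁻¹ (p * q)
  {{nonNeg*nonNeg⇒nonNeg p {{nonNegative 0≤p}} q {{nonNegative 0≤q}}}}

p≤q+p : ∀ {p q} → 0ℚ ≤ q → p ≤ q + p
p≤q+p {p} {q} 0≤q = subst (_≤ q + p) (+-identityˡ p) (+-monoˡ-≤ p 0≤q)

p≤q⇒0≤q-p : ∀ {p q} → p ≤ q → 0ℚ ≤ q - p
p≤q⇒0≤q-p {p} {q} p≤q = subst (_≤ q - p) (+-inverseʳ p) (+-monoˡ-≤ (- p) p≤q)

module _ {A : Set} where

  sumℚ-cong : ∀ (xs : List A) {g h} → g ≗ h → sumℚ xs g ≡ sumℚ xs h
  sumℚ-cong []       g≗h = refl
  sumℚ-cong (x ∷ xs) g≗h = cong₂ _+_ (g≗h x) (sumℚ-cong xs g≗h)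

  sumℚ-+ : ∀ (xs : List A) g h → sumℚ xs (λ x → g x + h x) ≡ sumℚ xs g + sumℚ xs h
  sumℚ-+ []       g h = sym (+-identityʳ 0ℚ)
  sumℚ-+ (x ∷ xs) g h =
    trans (cong (g x + h x +_) (sumℚ-+ xs g h)) (+-interchange (g x) (h x) (sumℚ xs g) (sumℚ xs h))

  sumℚ-*ˡ : ∀ (xs : List A) k g → sumℚ xs (λ x → k * g x) ≡ k * sumℚ xs g
  sumℚ-*ˡ []       k g = sym (*-zeroʳ k)
  sumℚ-*ˡ (x ∷ xs) k g =
    trans (cong (k * g x +_) (sumℚ-*ˡ xs k g)) (sym (*-distribˡ-+ k (g x) (sumℚ xs g)))

  sumℚ-nonNeg : ∀ (xs : List A) {g} → (∀ x → 0ℚ ≤ g x) → 0ℚ ≤ sumℚ xs g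
  sumℚ-nonNeg []       g≥0 = ≤-refl
  sumℚ-nonNeg (x ∷ xs) g≥0 = +-nonNeg (g≥0 x) (sumℚ-nonNeg xs g≥0)

is-nothing⇒≡nothing : ∀ {A : Set} (m : Maybe A) → T (is-nothing m) → m ≡ nothing
is-nothing⇒≡nothing nothing _ = refl

-- 0ℚ on [] is a junk value: optimum only minimises over the free variables of a subcube on which f
-- is not constant, and such a subcube has one.
minimum : List ℚ → ℚ
minimum []       = 0ℚ
minimum (q ∷ qs) = min q qs

minimum-≤ : ∀ {q qs} → q ∈ qs → minimum qs ≤ q
minimum-≤ {qs = q ∷ qs} (here refl) = min≤⊤ q qs
minimum-≤ {qs = q′ ∷ qs} (there q∈qs) = min≤v⁺ q′ qs (inj₂ (Any.map (λ { refl → ≤-refl }) q∈qs))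

prodFin-nonNeg : ∀ {n} {g : Fin n → ℚ} → (∀ i → 0ℚ ≤ g i) → 0ℚ ≤ prodFin g
prodFin-nonNeg {zero}  g≥0 = nonNegative⁻¹ 1ℚ
prodFin-nonNeg {suc n} g≥0 = *-nonNeg (g≥0 zero) (prodFin-nonNeg (g≥0 ∘ suc))

prob-nonNeg : ∀ {n} {p : Fin n → ℚ} → (∀ i → 0ℚ ≤ p i × p i ≤ 1ℚ) → ∀ x → 0ℚ ≤ prob p x
prob-nonNeg {p = p} p∈[0,1] x = prodFin-nonNeg factor-nonNeg
  where
  factor-nonNeg : ∀ i → 0ℚ ≤ (if x i then p i else 1ℚ - p i)
  factor-nonNeg i with x i
  ... | true  = proj₁ (p∈[0,1] i)
  ... | false = p≤q⇒0≤q-p (proj₂ (p∈[0,1] i))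

cons-≗ : ∀ {n b} {y : Assignment (suc n)} {z} → y zero ≡ b → z ≗ tail y → cons b z ≗ y
cons-≗ y₀ z≗ zero    = sym y₀
cons-≗ y₀ z≗ (suc i) = z≗ i

allAssignments-complete : ∀ {n} (y : Assignment n) → Any (_≗ y) (allAssignments n)
allAssignments-complete {zero}  y = here (λ ())
allAssignments-complete {suc n} y with y zero in y₀
... | false = ++⁺ˡ (map⁺ (Any.map (cons-≗ y₀) (allAssignments-complete (tail y))))
... | true  = ++⁺ʳ _ (map⁺ (Any.map (cons-≗ y₀) (allAssignments-complete (tail y))))

ones-resp : ∀ {n} → ones {n} Preserves _≗_ ⟶ _≡_
ones-resp {zero}  x≗y = refl
ones-resp {suc n} x≗y = cong₂ (λ b m → (if b then 1 else 0) ℕ.+ m) (x≗y zero) (ones-resp (x≗y ∘ suc))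

symmetric-resp : ∀ {n} {f : Assignment n → Bool} → Symmetric f → f Preserves _≗_ ⟶ _≡_
symmetric-resp symmetric {x} {y} x≗y = symmetric x y (ones-resp x≗y)

costAt-branch : ∀ {n} (c : Fin n → ℚ) b t₀ t₁ x → costAt c b t₀ t₁ x ≡ cost c (branch b t₀ t₁) x
costAt-branch c false t₀ t₁ x = refl
costAt-branch c true  t₀ t₁ x = refl

cost-nonNeg : ∀ {n} {c : Fin n → ℚ} → (∀ i → 0ℚ ≤ c i) → ∀ t x → 0ℚ ≤ cost c t x
cost-nonNeg c≥0 stop           x = ≤-refl
cost-nonNeg c≥0 (test i t₀ t₁) x with x i
... | false = +-nonNeg (c≥0 i) (cost-nonNeg c≥0 t₀ x)
... | true  = +-nonNeg (c≥0 i) (cost-nonNeg c≥0 t₁ x)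

validAt⇒validRun : ∀ {n} {f : Assignment n → Bool} b {t₀ t₁ S x} →
                   ValidAt f b t₀ t₁ S x → ValidRun f (branch b t₀ t₁) S x
validAt⇒validRun false valid = valid
validAt⇒validRun true  valid = valid

validRun-branch : ∀ {n} {f : Assignment n → Bool} {i t₀ t₁ S x b} →
                  ValidRun f (test i t₀ t₁) S x → x i ≡ b → ValidRun f (branch b t₀ t₁) (i ∷ S) x
validRun-branch {i = i} {x = x} (_ , valid) refl = validAt⇒validRun (x i) valid

-- Coordinate i of the subcube ρ is fixed to b when ρ i ≡ just b and free when ρ i ≡ nothing.
Cube : ℕ → Set
Cube n = Vector (Maybe Bool) n

full : ∀ {n} → Cube n
full _ = nothing

fix : ∀ {n} → Cube n → Fin n → Bool → Cube n
fix ρ i b = updateAt ρ i (const (just b))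

point : ∀ {n} → Cube n → Assignment n
point ρ i = fromMaybe false (ρ i)

agrees : Maybe Bool → Bool → Bool
agrees nothing  y = true
agrees (just b) y = does (y Bool.≟ b)

inCube : ∀ {n} → Cube n → Assignment n → Bool
inCube {zero}  ρ x = true
inCube {suc n} ρ x = agrees (head ρ) (head x) ∧ inCube (tail ρ) (tail x)

agrees-just : ∀ {b y} → T (agrees (just b) y) → y ≡ b
agrees-just {false} {false} _ = refl
agrees-just {true}  {true}  _ = refl

agrees-refl : ∀ b → T (agrees (just b) b)
agrees-refl false = _
agrees-refl true  = _

agrees-intro : ∀ m {y} → (∀ {b} → m ≡ just b → y ≡ b) → T (agrees m y)
agrees-intro nothing  y≡ = _
agrees-intro (just b) y≡ with y≡ refl
... | refl = agrees-refl b

Fixed : ∀ {n} → Cube n → Fin n → Set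
Fixed ρ i = ∃ λ b → ρ i ≡ just b

inCube-fixed : ∀ {n} {ρ : Cube n} {x} → T (inCube ρ x) → ∀ {i b} → ρ i ≡ just b → x i ≡ b
inCube-fixed {ρ = ρ} {x} x∈ρ {zero} ρ₀≡b =
  agrees-just (subst (λ m → T (agrees m (head x))) ρ₀≡b (proj₁ (Equivalence.to T-∧ x∈ρ)))
inCube-fixed {ρ = ρ} {x} x∈ρ {suc i} ρᵢ≡b =
  inCube-fixed {ρ = tail ρ} {tail x} (proj₂ (Equivalence.to (T-∧ {agrees (head ρ) (head x)}) x∈ρ)) ρᵢ≡b

inCube-intro : ∀ {n} {ρ : Cube n} {x} → (∀ i {b} → ρ i ≡ just b → x i ≡ b) → T (inCube ρ x)
inCube-intro {zero}  x≡ = _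
inCube-intro {suc n} {ρ} {x} x≡ =
  Equivalence.from T-∧ (agrees-intro (head ρ) (x≡ zero) , inCube-intro {ρ = tail ρ} {tail x} (x≡ ∘ suc))

inCube-resp : ∀ {n} {ρ : Cube n} {x y} → x ≗ y → T (inCube ρ x) → T (inCube ρ y)
inCube-resp {ρ = ρ} {x} {y} x≗y x∈ρ =
  inCube-intro {ρ = ρ} {y} (λ i ρᵢ≡b → trans (sym (x≗y i)) (inCube-fixed {ρ = ρ} {x} x∈ρ ρᵢ≡b))

point-inCube : ∀ {n} (ρ : Cube n) → T (inCube ρ (point ρ))
point-inCube ρ = inCube-intro {ρ = ρ} (λ i → cong (fromMaybe false))

inCube-full : ∀ {n} (x : Assignment n) → T (inCube full x)
inCube-full x = inCube-intro {ρ = full} {x} (λ i ())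

inCube-fix : ∀ {n} {ρ : Cube n} {i b} x → ρ i ≡ nothing →
             inCube (fix ρ i b) x ≡ does (x i Bool.≟ b) ∧ inCube ρ x
inCube-fix {i = zero}  x ρ₀≡nothing rewrite ρ₀≡nothing = refl
inCube-fix {ρ = ρ} {suc i} {b} x ρᵢ≡nothing with agrees (head ρ) (head x)
... | true  = inCube-fix (tail x) ρᵢ≡nothing
... | false = sym (∧-zeroʳ (does (x (suc i) Bool.≟ b)))

inCube-fix⁺ : ∀ {n} {ρ : Cube n} {i b} x → ρ i ≡ nothing → x i ≡ b → T (inCube ρ x) → T (inCube (fix ρ i b) x)
inCube-fix⁺ {ρ = ρ} {i} x ρᵢ≡nothing refl x∈ρ =
  subst T (sym (inCube-fix {ρ = ρ} x ρᵢ≡nothing)) (Equivalence.from T-∧ (agrees-refl (x i) , x∈ρ))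

inCube-fix⁻ : ∀ {n} {ρ : Cube n} {i b} x → ρ i ≡ nothing → T (inCube (fix ρ i b) x) → T (inCube ρ x) × x i ≡ b
inCube-fix⁻ {ρ = ρ} {i} {b} x ρᵢ≡nothing x∈ρ′
  with Equivalence.to T-∧ (subst T (inCube-fix {ρ = ρ} {i} {b} x ρᵢ≡nothing) x∈ρ′)
... | xᵢ≡b , x∈ρ = x∈ρ , agrees-just xᵢ≡b

fix-Fixed : ∀ {n} (ρ : Cube n) i b → Fixed (fix ρ i b) i
fix-Fixed ρ i b = b , updateAt-updates i ρ

fix-preserves-Fixed : ∀ {n} {ρ : Cube n} {i b j} → Fixed ρ j → Fixed (fix ρ i b) j
fix-preserves-Fixed {ρ = ρ} {i} {b} {j} (b′ , ρⱼ≡b′) with j Fin.≟ i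
... | yes refl = fix-Fixed ρ i b
... | no  j≢i  = b′ , trans (updateAt-minimal j i ρ j≢i) ρⱼ≡b′

Fixed-fix⁻ : ∀ {n} {ρ : Cube n} {i b j} → Fixed (fix ρ i b) j → j ≡ i ⊎ Fixed ρ j
Fixed-fix⁻ {ρ = ρ} {i} {b} {j} (b′ , ρ′ⱼ≡b′) with j Fin.≟ i
... | yes j≡i = inj₁ j≡i
... | no  j≢i = inj₂ (b′ , trans (sym (updateAt-minimal j i ρ j≢i)) ρ′ⱼ≡b′)

fix-All-Fixed : ∀ {n} {ρ : Cube n} {i b S} → All (Fixed ρ) S → All (Fixed (fix ρ i b)) (i ∷ S)
fix-All-Fixed {ρ = ρ} {i} {b} fixed = fix-Fixed ρ i b ∷ All.map (fix-preserves-Fixed {ρ = ρ} {i} {b}) fixed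

fix-Fixed⊆ : ∀ {n} {ρ : Cube n} {i b S} → (∀ {j} → Fixed ρ j → j ∈ S) → ∀ {j} → Fixed (fix ρ i b) j → j ∈ i ∷ S
fix-Fixed⊆ {ρ = ρ} {i} {b} fixed⊆S fixedⱼ with Fixed-fix⁻ {ρ = ρ} {i} {b} fixedⱼ
... | inj₁ refl   = here refl
... | inj₂ fixedⱼ = there (fixed⊆S fixedⱼ)

inCube⇒consistent : ∀ {n} {ρ : Cube n} {S x y} → All (Fixed ρ) S →
                    T (inCube ρ x) → T (inCube ρ y) → Consistent S x y
inCube⇒consistent {ρ = ρ} {x = x} {y} fixed x∈ρ y∈ρ =
  All.map (λ (_ , ρᵢ≡b) → trans (inCube-fixed {ρ = ρ} {x} x∈ρ ρᵢ≡b)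
                                 (sym (inCube-fixed {ρ = ρ} {y} y∈ρ ρᵢ≡b))) fixed

consistent⇒inCube : ∀ {n} {ρ : Cube n} {S x y} → (∀ {i} → Fixed ρ i → i ∈ S) →
                    T (inCube ρ x) → Consistent S x y → T (inCube ρ y)
consistent⇒inCube {ρ = ρ} {x = x} {y} fixed⊆S x∈ρ x≈y =
  inCube-intro {ρ = ρ} {y} (λ i ρᵢ≡b → trans (sym (All.lookup x≈y (fixed⊆S (_ , ρᵢ≡b))))
                                              (inCube-fixed {ρ = ρ} {x} x∈ρ ρᵢ≡b))

module WeightedCost {n : ℕ} (c : Fin n → ℚ) (w : Assignment n → ℚ) where

  private
    L : List (Assignment n)
    L = allAssignments n

  weightOn : Cube n → Assignment n → ℚ
  weightOn ρ x = if inCube ρ x then w x else 0ℚ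

  mass : Cube n → ℚ
  mass ρ = sumℚ L (weightOn ρ)

  costOn : Tree n → Cube n → ℚ
  costOn t ρ = sumℚ L (λ x → cost c t x * weightOn ρ x)

  weightOn-full : ∀ x → weightOn full x ≡ w x
  weightOn-full x = cong (if_then w x else 0ℚ) (Equivalence.to T-≡ (inCube-full x))

  weightOn-fix : ∀ {ρ i b} x → ρ i ≡ nothing →
                 weightOn (fix ρ i b) x ≡ (if does (x i Bool.≟ b) then weightOn ρ x else 0ℚ)
  weightOn-fix {ρ} {i} {b} x ρᵢ≡nothing rewrite inCube-fix {ρ = ρ} {i} {b} x ρᵢ≡nothing
    with does (x i Bool.≟ b)
  ... | true  = refl
  ... | false = refl

  costOn-full : ∀ t → costOn t full ≡ sumℚ L (λ x → cost c t x * w x)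
  costOn-full t = sumℚ-cong L (λ x → cong (cost c t x *_) (weightOn-full x))

  costOn-test : ∀ ρ i t₀ t₁ → costOn (test i t₀ t₁) ρ ≡
                c i * mass ρ + sumℚ L (λ x → costAt c (x i) t₀ t₁ x * weightOn ρ x)
  costOn-test ρ i t₀ t₁ = begin
    sumℚ L (λ x → (c i + rest x) * weightOn ρ x)
      ≡⟨ sumℚ-cong L (λ x → *-distribʳ-+ (weightOn ρ x) (c i) (rest x)) ⟩
    sumℚ L (λ x → c i * weightOn ρ x + rest x * weightOn ρ x)
      ≡⟨ sumℚ-+ L (λ x → c i * weightOn ρ x) (λ x → rest x * weightOn ρ x) ⟩
    sumℚ L (λ x → c i * weightOn ρ x) + restOn
      ≡⟨ cong (_+ restOn) (sumℚ-*ˡ L (c i) (weightOn ρ)) ⟩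
    c i * mass ρ + restOn ∎
    where
    open ≡-Reasoning
    rest : Assignment n → ℚ
    rest x = costAt c (x i) t₀ t₁ x
    restOn : ℚ
    restOn = sumℚ L (λ x → rest x * weightOn ρ x)

  costOn-test-fixed : ∀ {ρ i b} t₀ t₁ → ρ i ≡ just b →
                      costOn (test i t₀ t₁) ρ ≡ c i * mass ρ + costOn (branch b t₀ t₁) ρ
  costOn-test-fixed {ρ} {i} {b} t₀ t₁ ρᵢ≡b =
    trans (costOn-test ρ i t₀ t₁) (cong (c i * mass ρ +_) (sumℚ-cong L tested))
    where
    tested : ∀ x → costAt c (x i) t₀ t₁ x * weightOn ρ x ≡ cost c (branch b t₀ t₁) x * weightOn ρ x
    tested x with inCube ρ x in x∈ρ
    ... | false = trans (*-zeroʳ (costAt c (x i) t₀ t₁ x)) (sym (*-zeroʳ (cost c (branch b t₀ t₁) x)))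
    ... | true rewrite inCube-fixed {ρ = ρ} {x} (Equivalence.from T-≡ x∈ρ) ρᵢ≡b =
      cong (_* w x) (costAt-branch c b t₀ t₁ x)

  costOn-test-free : ∀ {ρ i} t₀ t₁ → ρ i ≡ nothing →
                     costOn (test i t₀ t₁) ρ ≡
                     c i * mass ρ + (costOn t₀ (fix ρ i false) + costOn t₁ (fix ρ i true))
  costOn-test-free {ρ} {i} t₀ t₁ ρᵢ≡nothing =
    trans (costOn-test ρ i t₀ t₁) (cong (c i * mass ρ +_) (trans (sumℚ-cong L tested) (sumℚ-+ L _ _)))
    where
    tested : ∀ x → costAt c (x i) t₀ t₁ x * weightOn ρ x ≡
                   cost c t₀ x * weightOn (fix ρ i false) x + cost c t₁ x * weightOn (fix ρ i true) x
    tested x rewrite weightOn-fix {ρ} {i} {false} x ρᵢ≡nothing | weightOn-fix {ρ} {i} {true} x ρᵢ≡nothing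
      with x i
    ... | false = sym (trans (cong (cost c t₀ x * weightOn ρ x +_) (*-zeroʳ (cost c t₁ x)))
                             (+-identityʳ (cost c t₀ x * weightOn ρ x)))
    ... | true  = sym (trans (cong (_+ cost c t₁ x * weightOn ρ x) (*-zeroʳ (cost c t₀ x)))
                             (+-identityˡ (cost c t₁ x * weightOn ρ x)))

  module _ (c≥0 : ∀ i → 0ℚ ≤ c i) (w≥0 : ∀ x → 0ℚ ≤ w x) where

    weightOn-nonNeg : ∀ ρ x → 0ℚ ≤ weightOn ρ x
    weightOn-nonNeg ρ x with inCube ρ x
    ... | true  = w≥0 x
    ... | false = ≤-refl

    mass-nonNeg : ∀ ρ → 0ℚ ≤ mass ρ
    mass-nonNeg ρ = sumℚ-nonNeg L (weightOn-nonNeg ρ)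

    costOn-nonNeg : ∀ t ρ → 0ℚ ≤ costOn t ρ
    costOn-nonNeg t ρ = sumℚ-nonNeg L (λ x → *-nonNeg (cost-nonNeg c≥0 t x) (weightOn-nonNeg ρ x))

module Evaluation {n : ℕ} (f : Assignment n → Bool) (f-resp : f Preserves _≗_ ⟶ _≡_) where

  private
    L : List (Assignment n)
    L = allAssignments n

  ConstantOn : Cube n → Set
  ConstantOn ρ = ∀ y → T (inCube ρ y) → f y ≡ f (point ρ)

  constantOn? : ∀ ρ → Dec (ConstantOn ρ)
  constantOn? ρ = map′ fromAll (λ constant → All.tabulate (λ {y} _ → constant y))
    (All.all? (λ y → T? (inCube ρ y) →-dec f y Bool.≟ f (point ρ)) L)
    where
    fromAll : All (λ y → T (inCube ρ y) → f y ≡ f (point ρ)) L → ConstantOn ρ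
    fromAll constant y y∈ρ with All.lookupAny constant (allAssignments-complete y)
    ... | z-const , z≗y = trans (sym (f-resp z≗y)) (z-const (inCube-resp {ρ = ρ} (sym ∘ z≗y) y∈ρ))

  determined⇒constantOn : ∀ {ρ S x} → All (Fixed ρ) S → T (inCube ρ x) → Determined f S x → ConstantOn ρ
  determined⇒constantOn {ρ} fixed x∈ρ det y y∈ρ =
    trans (det y (inCube⇒consistent fixed x∈ρ y∈ρ))
          (sym (det (point ρ) (inCube⇒consistent fixed x∈ρ (point-inCube ρ))))

  constantOn⇒determined : ∀ {ρ S x} → (∀ {i} → Fixed ρ i → i ∈ S) → T (inCube ρ x) →
                          ConstantOn ρ → Determined f S x
  constantOn⇒determined {x = x} fixed⊆S x∈ρ constant y x≈y =
    trans (constant y (consistent⇒inCube fixed⊆S x∈ρ x≈y)) (sym (constant x x∈ρ))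

  isStrategyOn : Tree n → Cube n → Bool
  isStrategyOn stop           ρ = isYes (constantOn? ρ)
  isStrategyOn (test i t₀ t₁) ρ = isNo (constantOn? ρ) ∧ is-nothing (ρ i) ∧
    isStrategyOn t₀ (fix ρ i false) ∧ isStrategyOn t₁ (fix ρ i true)

  isStrategyOn-test⁻ : ∀ {i t₀ t₁ ρ} → T (isStrategyOn (test i t₀ t₁) ρ) →
    ¬ ConstantOn ρ × ρ i ≡ nothing × T (isStrategyOn t₀ (fix ρ i false)) × T (isStrategyOn t₁ (fix ρ i true))
  isStrategyOn-test⁻ {i} {t₀} {t₁} {ρ} ok with Equivalence.to (T-∧ {isNo (constantOn? ρ)}) ok
  ... | nonconstant , ok′ with Equivalence.to (T-∧ {is-nothing (ρ i)}) ok′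
  ... | free , ok″ with Equivalence.to (T-∧ {isStrategyOn t₀ (fix ρ i false)}) ok″
  ... | ok₀ , ok₁ =
    toWitnessFalse {a? = constantOn? ρ} nonconstant , is-nothing⇒≡nothing (ρ i) free , ok₀ , ok₁

  isStrategyOn-sound : ∀ t ρ {S} → T (isStrategyOn t ρ) → All (Fixed ρ) S → (∀ {i} → Fixed ρ i → i ∈ S) →
                       ∀ x → T (inCube ρ x) → ValidRun f t S x
  isStrategyOn-sound stop ρ ok fixed fixed⊆S x x∈ρ =
    constantOn⇒determined fixed⊆S x∈ρ (toWitness {a? = constantOn? ρ} ok)
  isStrategyOn-sound (test i t₀ t₁) ρ {S} ok fixed fixed⊆S x x∈ρ
    with isStrategyOn-test⁻ {i} {t₀} {t₁} {ρ} ok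
  ... | nonconstant , ρᵢ≡nothing , ok₀ , ok₁ = (nonconstant ∘ determined⇒constantOn fixed x∈ρ) , branchValid
    where
    branchValid : ValidAt f (x i) t₀ t₁ (i ∷ S) x
    branchValid with x i in xᵢ
    ... | false = isStrategyOn-sound t₀ (fix ρ i false) ok₀ (fix-All-Fixed fixed) (fix-Fixed⊆ fixed⊆S)
                    x (inCube-fix⁺ x ρᵢ≡nothing xᵢ x∈ρ)
    ... | true  = isStrategyOn-sound t₁ (fix ρ i true) ok₁ (fix-All-Fixed fixed) (fix-Fixed⊆ fixed⊆S)
                    x (inCube-fix⁺ x ρᵢ≡nothing xᵢ x∈ρ)

  isStrategyOn-full-sound : ∀ t → T (isStrategyOn t full) → IsEvalStrategy f t
  isStrategyOn-full-sound t ok x = isStrategyOn-sound t full ok [] (λ ()) x (inCube-full x)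

  validRun-fixed : ∀ {ρ : Cube n} {i b t₀ t₁ S} → ρ i ≡ just b →
                   (∀ x → T (inCube ρ x) → ValidRun f (test i t₀ t₁) S x) →
                   ∀ x → T (inCube ρ x) → ValidRun f (branch b t₀ t₁) (i ∷ S) x
  validRun-fixed {ρ} ρᵢ≡b valid x x∈ρ = validRun-branch (valid x x∈ρ) (inCube-fixed {ρ = ρ} {x} x∈ρ ρᵢ≡b)

  validRun-free : ∀ {ρ : Cube n} {i b t₀ t₁ S} → ρ i ≡ nothing →
                  (∀ x → T (inCube ρ x) → ValidRun f (test i t₀ t₁) S x) →
                  ∀ x → T (inCube (fix ρ i b) x) → ValidRun f (branch b t₀ t₁) (i ∷ S) x
  validRun-free {ρ} {i} {b} ρᵢ≡nothing valid x x∈ρ′ with inCube-fix⁻ {ρ = ρ} {i} {b} x ρᵢ≡nothing x∈ρ′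
  ... | x∈ρ , xᵢ≡b = validRun-branch (valid x x∈ρ) xᵢ≡b

  freeVariables : Cube n → List (Fin n)
  freeVariables ρ = filter (λ i → T? (is-nothing (ρ i))) (allFin n)

  module Optimum (c : Fin n → ℚ) (w : Assignment n → ℚ) where
    open WeightedCost c w

    -- Truncating at depth k with value 0 makes optimum k a lower bound for every k (optimum-≤-costOn);
    -- for k = n it is the exact optimum.
    optimum             : ℕ → Cube n → ℚ
    optimumTestingFirst : ℕ → Cube n → Fin n → ℚ
    optimum zero    ρ = 0ℚ
    optimum (suc k) ρ =
      if does (constantOn? ρ) then 0ℚ else minimum (map (optimumTestingFirst k ρ) (freeVariables ρ))
    optimumTestingFirst k ρ i = c i * mass ρ + (optimum k (fix ρ i false) + optimum k (fix ρ i true))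

    optimum-constant : ∀ k {ρ} → ConstantOn ρ → optimum (suc k) ρ ≡ 0ℚ
    optimum-constant k {ρ} constant rewrite dec-true (constantOn? ρ) constant = refl

    optimum-≤-testing : ∀ k {ρ i} → ¬ ConstantOn ρ → ρ i ≡ nothing →
                        optimum (suc k) ρ ≤ optimumTestingFirst k ρ i
    optimum-≤-testing k {ρ} {i} nonconstant ρᵢ≡nothing rewrite dec-false (constantOn? ρ) nonconstant =
      minimum-≤ (∈-map⁺ (optimumTestingFirst k ρ)
        (∈-filter⁺ (λ j → T? (is-nothing (ρ j))) (∈-allFin i) (subst (T ∘ is-nothing) (sym ρᵢ≡nothing) _)))

    module _ (c≥0 : ∀ i → 0ℚ ≤ c i) (w≥0 : ∀ x → 0ℚ ≤ w x) where

      costOn-branch-≤-test : ∀ {ρ i b} t₀ t₁ → ρ i ≡ just b →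
                             costOn (branch b t₀ t₁) ρ ≤ costOn (test i t₀ t₁) ρ
      costOn-branch-≤-test {ρ} {i} {b} t₀ t₁ ρᵢ≡b = begin
        costOn (branch b t₀ t₁) ρ                ≤⟨ p≤q+p (*-nonNeg (c≥0 i) (mass-nonNeg c≥0 w≥0 ρ)) ⟩
        c i * mass ρ + costOn (branch b t₀ t₁) ρ ≡⟨ costOn-test-fixed t₀ t₁ ρᵢ≡b ⟨
        costOn (test i t₀ t₁) ρ                  ∎
        where open ≤-Reasoning

      optimum-≤-costOn : ∀ k t ρ {S} → All (Fixed ρ) S → (∀ x → T (inCube ρ x) → ValidRun f t S x) →
                         optimum k ρ ≤ costOn t ρ
      optimum-≤-costOn zero t ρ _ _ = costOn-nonNeg c≥0 w≥0 t ρ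
      optimum-≤-costOn (suc k) stop ρ fixed valid =
        ≤-trans (≤-reflexive (optimum-constant k constant)) (costOn-nonNeg c≥0 w≥0 stop ρ)
        where
        constant : ConstantOn ρ
        constant = determined⇒constantOn fixed (point-inCube ρ) (valid (point ρ) (point-inCube ρ))
      optimum-≤-costOn (suc k) (test i t₀ t₁) ρ fixed valid with ρ i in ρᵢ
      ... | just false =
        ≤-trans (optimum-≤-costOn (suc k) t₀ ρ ((false , ρᵢ) ∷ fixed) (validRun-fixed ρᵢ valid))
                (costOn-branch-≤-test t₀ t₁ ρᵢ)
      ... | just true  =
        ≤-trans (optimum-≤-costOn (suc k) t₁ ρ ((true , ρᵢ) ∷ fixed) (validRun-fixed ρᵢ valid))
                (costOn-branch-≤-test t₀ t₁ ρᵢ)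
      ... | nothing with constantOn? ρ
      ...   | yes constant =
        ≤-trans (≤-reflexive (optimum-constant k constant)) (costOn-nonNeg c≥0 w≥0 (test i t₀ t₁) ρ)
      ...   | no nonconstant = begin
        optimum (suc k) ρ
          ≤⟨ optimum-≤-testing k nonconstant ρᵢ ⟩
        c i * mass ρ + (optimum k (fix ρ i false) + optimum k (fix ρ i true))
          ≤⟨ +-monoʳ-≤ (c i * mass ρ) (+-mono-≤ after₀ after₁) ⟩
        c i * mass ρ + (costOn t₀ (fix ρ i false) + costOn t₁ (fix ρ i true))
          ≡⟨ costOn-test-free t₀ t₁ ρᵢ ⟨
        costOn (test i t₀ t₁) ρ ∎
        where
        open ≤-Reasoning
        after₀ : optimum k (fix ρ i false) ≤ costOn t₀ (fix ρ i false)
        after₀ = optimum-≤-costOn k t₀ (fix ρ i false) (fix-All-Fixed fixed) (validRun-free ρᵢ valid)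
        after₁ : optimum k (fix ρ i true) ≤ costOn t₁ (fix ρ i true)
        after₁ = optimum-≤-costOn k t₁ (fix ρ i true)  (fix-All-Fixed fixed) (validRun-free ρᵢ valid)

  open Optimum

  probWhere : Bool → (Fin n → ℚ) → Assignment n → ℚ
  probWhere ℓ p x = if does (f x Bool.≟ ℓ) then prob p x else 0ℚ

  probWhere-nonNeg : ∀ {p} → (∀ i → 0ℚ ≤ p i × p i ≤ 1ℚ) → ∀ ℓ x → 0ℚ ≤ probWhere ℓ p x
  probWhere-nonNeg p∈[0,1] ℓ x with does (f x Bool.≟ ℓ)
  ... | true  = prob-nonNeg p∈[0,1] x
  ... | false = ≤-refl

  verCost-split : ∀ c p A₀ A₁ → verCost f c p A₀ A₁ ≡
    sumℚ L (λ x → cost c A₀ x * probWhere false p x) + sumℚ L (λ x → cost c A₁ x * probWhere true p x)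
  verCost-split c p A₀ A₁ = trans (sumℚ-cong L split) (sumℚ-+ L _ _)
    where
    split : ∀ x → cost c (if f x then A₁ else A₀) x * prob p x ≡
                  cost c A₀ x * probWhere false p x + cost c A₁ x * probWhere true p x
    split x with f x
    ... | false = sym (trans (cong (cost c A₀ x * prob p x +_) (*-zeroʳ (cost c A₁ x)))
                             (+-identityʳ (cost c A₀ x * prob p x)))
    ... | true  = sym (trans (cong (_+ cost c A₁ x * prob p x) (*-zeroʳ (cost c A₀ x)))
                             (+-identityˡ (cost c A₁ x * prob p x)))

  optimum-≤-weightedCost : ∀ {c w} → (∀ i → 0ℚ ≤ c i) → (∀ x → 0ℚ ≤ w x) → ∀ t → IsEvalStrategy f t →
                           optimum c w n full ≤ sumℚ L (λ x → cost c t x * w x)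
  optimum-≤-weightedCost {c} {w} c≥0 w≥0 t eval =
    subst (optimum c w n full ≤_) (WeightedCost.costOn-full c w t)
      (optimum-≤-costOn c w c≥0 w≥0 n t full [] (λ x _ → eval x))

  optimum-attained⇒IsE : ∀ {c p} t → (∀ i → 0ℚ ≤ c i) → (∀ i → 0ℚ ≤ p i × p i ≤ 1ℚ) →
    IsEvalStrategy f t → expCost c p t ≡ optimum c (prob p) n full → IsE f c p (expCost c p t)
  optimum-attained⇒IsE t c≥0 p∈[0,1] eval attained =
    (t , eval , refl) ,
    λ A evalA → subst (_≤ _) (sym attained) (optimum-≤-weightedCost c≥0 (prob-nonNeg p∈[0,1]) A evalA)

  optimum-attained⇒IsV : ∀ {c p} A₀ A₁ → (∀ i → 0ℚ ≤ c i) → (∀ i → 0ℚ ≤ p i × p i ≤ 1ℚ) →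
    IsEvalStrategy f A₀ → IsEvalStrategy f A₁ →
    verCost f c p A₀ A₁ ≡ optimum c (probWhere false p) n full + optimum c (probWhere true p) n full →
    IsV f c p (verCost f c p A₀ A₁)
  optimum-attained⇒IsV {c} {p} A₀ A₁ c≥0 p∈[0,1] eval₀ eval₁ attained =
    (A₀ , A₁ , eval₀ , eval₁ , refl) ,
    λ B₀ B₁ evalB₀ evalB₁ → subst₂ _≤_ (sym attained) (sym (verCost-split c p B₀ B₁))
      (+-mono-≤ (optimum-≤-weightedCost c≥0 (probWhere-nonNeg p∈[0,1] false) B₀ evalB₀)
                (optimum-≤-weightedCost c≥0 (probWhere-nonNeg p∈[0,1] true) B₁ evalB₁))

module Example where

  oneOrTwo : ℕ → Bool
  oneOrTwo 1 = true
  oneOrTwo 2 = true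
  oneOrTwo _ = false

  f : Assignment 4 → Bool
  f x = oneOrTwo (ones x)

  f-symmetric : Symmetric f
  f-symmetric x y = cong oneOrTwo

  c : Fin 4 → ℚ
  c zero                   = ℤ.+ 3 / 1
  c (suc zero)             = ℤ.+ 3 / 1
  c (suc (suc zero))       = ℤ.+ 4 / 1
  c (suc (suc (suc zero))) = ℤ.+ 4 / 1

  p : Fin 4 → ℚ
  p zero                   = ℤ.+ 3 / 10
  p (suc zero)             = ℤ.+ 4 / 5
  p (suc (suc zero))       = ℤ.+ 1 / 2
  p (suc (suc (suc zero))) = ℤ.+ 7 / 10

  c-pos : ∀ i → 0ℚ < c i
  c-pos = toWitness {a? = Fin.all? (λ i → 0ℚ <? c i)} _

  p∈⟨0,1⟩ : ∀ i → 0ℚ < p i × p i < 1ℚ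
  p∈⟨0,1⟩ = toWitness {a? = Fin.all? (λ i → 0ℚ <? p i ×-dec p i <? 1ℚ)} _

  evaluator verifier₀ verifier₁ : Tree 4
  evaluator =
    test (# 2) (test (# 1) (test (# 3) (test (# 0) stop stop) stop) (test (# 0) stop (test (# 3) stop stop)))
               (test (# 3) (test (# 0) stop (test (# 1) stop stop)) (test (# 1) (test (# 0) stop stop) stop))
  verifier₀ =
    test (# 1) (test (# 0) (test (# 2) (test (# 3) stop stop) stop) (test (# 2) stop (test (# 3) stop stop)))
               (test (# 2) (test (# 0) stop (test (# 3) stop stop)) (test (# 3) (test (# 0) stop stop) stop))
  verifier₁ =
    test (# 0) (test (# 1) (test (# 3) (test (# 2) stop stop) stop) (test (# 2) stop (test (# 3) stop stop)))
               (test (# 2) (test (# 3) stop (test (# 1) stop stop)) (test (# 1) (test (# 3) stop stop) stop))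

  open Evaluation f (symmetric-resp f-symmetric)

  c≥0 : ∀ i → 0ℚ ≤ c i
  c≥0 = <⇒≤ ∘ c-pos

  p∈[0,1] : ∀ i → 0ℚ ≤ p i × p i ≤ 1ℚ
  p∈[0,1] i = <⇒≤ (proj₁ (p∈⟨0,1⟩ i)) , <⇒≤ (proj₂ (p∈⟨0,1⟩ i))

  𝓔 : IsE f c p (expCost c p evaluator)
  𝓔 = optimum-attained⇒IsE evaluator c≥0 p∈[0,1] (isStrategyOn-full-sound evaluator _) refl

  𝓥 : IsV f c p (verCost f c p verifier₀ verifier₁)
  𝓥 = optimum-attained⇒IsV verifier₀ verifier₁ c≥0 p∈[0,1]
        (isStrategyOn-full-sound verifier₀ _) (isStrategyOn-full-sound verifier₁ _) refl

  𝓥<𝓔 : verCost f c p verifier₀ verifier₁ < expCost c p evaluator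
  𝓥<𝓔 = toWitness {a? = verCost f c p verifier₀ verifier₁ <? expCost c p evaluator} _

theorem4 : Σ ℕ λ n → Σ (Assignment n → Bool) λ f →
    Σ (Fin n → ℚ) λ c → Σ (Fin n → ℚ) λ p →
      Symmetric f × (∀ i → 0ℚ < c i) × (∀ i → (0ℚ < p i) × (p i < 1ℚ)) ×
      (Σ ℚ λ v → Σ ℚ λ e → IsV f c p v × IsE f c p e × v < e)
theorem4 = 4 , f , c , p , f-symmetric , c-pos , p∈⟨0,1⟩ ,
           verCost f c p verifier₀ verifier₁ , expCost c p evaluator , 𝓥 , 𝓔 , 𝓥<𝓔
  where open Example
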